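{- Let $X,Y$ be sets, $\sigma\in\Sigma^X$ and $f:X\to Y$. Then $[\![\dot{\textstyle\bigvee}\{\sigma_x:x\in f^{ -1}(y)\}]\!]_{y\in Y}=\exists f([\![\sigma]\!]_X)$ and $[\![\dot{\textstyle\bigwedge}\{\sigma_x:x\in f^{ -1}(y)\}]\!]_{y\in Y}=\forall f([\![\sigma]\!]_X)$ in $\mathsf{P}Y$.
   Context: $\mathsf{P}:\mathbf{Set}^{\mathrm{op}}\to\mathbf{HA}$ is a $\mathbf{Set}$-based tripos: a functor into Heyting algebras such that (1) each $\mathsf{P}f:\mathsf{P}Y\to\mathsf{P}X$ ($f:X\to Y$) has a left adjoint $\exists f$ and right adjoint $\forall f$ among monotone maps $\mathsf{P}X\to\mathsf{P}Y$; (2) for every pullback square in $\mathbf{Set}$ with $f_1:X\to X_1,f_2:X\to X_2,g_1:X_1\to Y,g_2:X_2\to Y$, one has $\exists f_1\circ\mathsf{P}f_2=\mathsf{P}g_1\circ\exists g_2$ and $\forall f_1\circ\mathsf{P}f_2=\mathsf{P}g_1\circ\forall g_2$; (3) there is a set $\Sigma$ and $\mathrm{tr}_\Sigma\in\mathsf{P}\Sigma$ such that for every set $X$ the map $\sigma\mapsto\mathsf{P}\sigma(\mathrm{tr}_\Sigma)$, $\Sigma^X\to\mathsf{P}X$, is surjective. Fix these; for $\sigma\in\Sigma^X$ write $[\![\sigma]\!]_X=[\![\sigma_x]\!]_{x\in X}:=\mathsf{P}\sigma(\mathrm{tr}_\Sigma)$. Let $E=\{(\xi,s)\in\Sigma\times\mathfrak{P}(\Sigma):\xi\in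 s\}$ with projections $e_1:E\to\Sigma$, $e_2:E\to\mathfrak{P}(\Sigma)$, and let $\dot\bigvee,\dot\bigwedge:\mathfrak{P}(\Sigma)\to\Sigma$ be any maps with $[\![\dot\bigvee]\!]_{\mathfrak{P}(\Sigma)}=\exists e_2([\![e_1]\!]_E)$ and $[\![\dot\bigwedge]\!]_{\mathfrak{P}(\Sigma)}=\forall e_2([\![e_1]\!]_E)$. The axiom of choice is assumed. -}

module Defs where

open import Level using (Level; _⊔_; Setω) renaming (suc to lsuc)
open import Relation.Binary.Lattice.Bundles using (HeytingAlgebra)
open import Relation.Binary.PropositionalEquality using (_≡_)
open import Data.Product using (Σ; Σ-syntax; ∃; _×_; _,_)
open import Function using (_∘_; id)

HA : (c ℓ : Level) → Set (lsuc (c ⊔ ℓ))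
HA c ℓ = HeytingAlgebra c ℓ ℓ

∣_∣ : ∀ {c ℓ} → HA c ℓ → Set c
∣ H ∣ = HeytingAlgebra.Carrier H

-- The data of a Set-indexed doctrine: P on objects, P on maps, and
-- (chosen) candidate left/right adjoints ∃ f, ∀ f.
-- "Sets" are Agda types of arbitrary universe level; P X lives one
-- level-join above X.
record Doctrine (c ℓ : Level) : Setω where
  field
    P  : ∀ {a} → Set a → HA (a ⊔ c) (a ⊔ ℓ)
    P₁ : ∀ {a b} {X : Set a} {Y : Set b} → (X → Y) → ∣ P Y ∣ → ∣ P X ∣
    ∃₁ : ∀ {a b} {X : Set a} {Y : Set b} → (X → Y) → ∣ P X ∣ → ∣ P Y ∣
    ∀₁ : ∀ {a b} {X : Set a} {Y : Set b} → (X → Y) → ∣ P X ∣ → ∣ P Y ∣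

  _⊢_≈_ : ∀ {a} (X : Set a) → ∣ P X ∣ → ∣ P X ∣ → Set (a ⊔ ℓ)
  X ⊢ φ ≈ ψ = HeytingAlgebra._≈_ (P X) φ ψ

  _⊢_≤_ : ∀ {a} (X : Set a) → ∣ P X ∣ → ∣ P X ∣ → Set (a ⊔ ℓ)
  X ⊢ φ ≤ ψ = HeytingAlgebra._≤_ (P X) φ ψ

record IsPullback {a a₁ a₂ b} {X : Set a} {X₁ : Set a₁} {X₂ : Set a₂} {Y : Set b}
                  (f₁ : X → X₁) (f₂ : X → X₂) (g₁ : X₁ → Y) (g₂ : X₂ → Y)
                  : Set (a ⊔ a₁ ⊔ a₂ ⊔ b) where
  field
    commutes : ∀ x → g₁ (f₁ x) ≡ g₂ (f₂ x)
    gap      : ∀ x₁ x₂ → g₁ x₁ ≡ g₂ x₂ → Σ[ x ∈ X ] (f₁ x ≡ x₁ × f₂ x ≡ x₂)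
    unique   : ∀ x x′ → f₁ x ≡ f₁ x′ → f₂ x ≡ f₂ x′ → x ≡ x′

record IsTripos {c ℓ} (D : Doctrine c ℓ) (s : Level) : Setω where
  open Doctrine D
  open HeytingAlgebra using (_∧_; _∨_; _⇨_; ⊤; ⊥)
  field
    P₁-mono : ∀ {a b} {X : Set a} {Y : Set b} (f : X → Y) {φ ψ : ∣ P Y ∣} →
              Y ⊢ φ ≤ ψ → X ⊢ P₁ f φ ≤ P₁ f ψ
    P₁-⊤ : ∀ {a b} {X : Set a} {Y : Set b} (f : X → Y) →
           X ⊢ P₁ f (⊤ (P Y)) ≈ ⊤ (P X)
    P₁-⊥ : ∀ {a b} {X : Set a} {Y : Set b} (f : X → Y) →
           X ⊢ P₁ f (⊥ (P Y)) ≈ ⊥ (P X)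
    P₁-∧ : ∀ {a b} {X : Set a} {Y : Set b} (f : X → Y) (φ ψ : ∣ P Y ∣) →
           X ⊢ P₁ f (_∧_ (P Y) φ ψ) ≈ _∧_ (P X) (P₁ f φ) (P₁ f ψ)
    P₁-∨ : ∀ {a b} {X : Set a} {Y : Set b} (f : X → Y) (φ ψ : ∣ P Y ∣) →
           X ⊢ P₁ f (_∨_ (P Y) φ ψ) ≈ _∨_ (P X) (P₁ f φ) (P₁ f ψ)
    P₁-⇨ : ∀ {a b} {X : Set a} {Y : Set b} (f : X → Y) (φ ψ : ∣ P Y ∣) →
           X ⊢ P₁ f (_⇨_ (P Y) φ ψ) ≈ _⇨_ (P X) (P₁ f φ) (P₁ f ψ)
    P₁-id : ∀ {a} {X : Set a} (φ : ∣ P X ∣) → X ⊢ P₁ id φ ≈ φ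
    P₁-∘  : ∀ {a b d} {X : Set a} {Y : Set b} {Z : Set d}
              (f : X → Y) (g : Y → Z) (φ : ∣ P Z ∣) →
            X ⊢ P₁ (g ∘ f) φ ≈ P₁ f (P₁ g φ)
    -- functions in Set are extensional
    P₁-ext : ∀ {a b} {X : Set a} {Y : Set b} (f g : X → Y) →
             (∀ x → f x ≡ g x) → (φ : ∣ P Y ∣) → X ⊢ P₁ f φ ≈ P₁ g φ
    ∃₁-mono : ∀ {a b} {X : Set a} {Y : Set b} (f : X → Y) {φ ψ : ∣ P X ∣} →
              X ⊢ φ ≤ ψ → Y ⊢ ∃₁ f φ ≤ ∃₁ f ψ
    ∀₁-mono : ∀ {a b} {X : Set a} {Y : Set b} (f : X → Y) {φ ψ : ∣ P X ∣} →
              X ⊢ φ ≤ ψ → Y ⊢ ∀₁ f φ ≤ ∀₁ f ψ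
    ∃₁-unit   : ∀ {a b} {X : Set a} {Y : Set b} (f : X → Y) (φ : ∣ P X ∣) (ψ : ∣ P Y ∣) →
                Y ⊢ ∃₁ f φ ≤ ψ → X ⊢ φ ≤ P₁ f ψ
    ∃₁-counit : ∀ {a b} {X : Set a} {Y : Set b} (f : X → Y) (φ : ∣ P X ∣) (ψ : ∣ P Y ∣) →
                X ⊢ φ ≤ P₁ f ψ → Y ⊢ ∃₁ f φ ≤ ψ
    ∀₁-unit   : ∀ {a b} {X : Set a} {Y : Set b} (f : X → Y) (ψ : ∣ P Y ∣) (φ : ∣ P X ∣) →
                X ⊢ P₁ f ψ ≤ φ → Y ⊢ ψ ≤ ∀₁ f φ
    ∀₁-counit : ∀ {a b} {X : Set a} {Y : Set b} (f : X → Y) (ψ : ∣ P Y ∣) (φ : ∣ P X ∣) →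
                Y ⊢ ψ ≤ ∀₁ f φ → X ⊢ P₁ f ψ ≤ φ
    BC-∃ : ∀ {a a₁ a₂ b} {X : Set a} {X₁ : Set a₁} {X₂ : Set a₂} {Y : Set b}
             (f₁ : X → X₁) (f₂ : X → X₂) (g₁ : X₁ → Y) (g₂ : X₂ → Y) →
           IsPullback f₁ f₂ g₁ g₂ → (φ : ∣ P X₂ ∣) →
           X₁ ⊢ ∃₁ f₁ (P₁ f₂ φ) ≈ P₁ g₁ (∃₁ g₂ φ)
    BC-∀ : ∀ {a a₁ a₂ b} {X : Set a} {X₁ : Set a₁} {X₂ : Set a₂} {Y : Set b}
             (f₁ : X → X₁) (f₂ : X → X₂) (g₁ : X₁ → Y) (g₂ : X₂ → Y) →
           IsPullback f₁ f₂ g₁ g₂ → (φ : ∣ P X₂ ∣) →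
           X₁ ⊢ ∀₁ f₁ (P₁ f₂ φ) ≈ P₁ g₁ (∀₁ g₂ φ)
    Sig  : Set s
    trΣ  : ∣ P Sig ∣
    generic : ∀ {a} (X : Set a) (φ : ∣ P X ∣) → Σ[ σ ∈ (X → Sig) ] (X ⊢ P₁ σ trΣ ≈ φ)

record Tripos (c ℓ s : Level) : Setω where
  field
    doctrine : Doctrine c ℓ
    isTripos : IsTripos doctrine s
  open Doctrine doctrine public
  open IsTripos isTripos public

  ⟦_⟧ : ∀ {a} {X : Set a} → (X → Sig) → ∣ P X ∣
  ⟦ σ ⟧ = P₁ σ trΣ

  𝔓 : (p : Level) → Set (lsuc p ⊔ s)
  𝔓 p = Sig → Set p

  E : (p : Level) → Set (lsuc p ⊔ s)
  E p = Σ[ ξ ∈ Sig ] Σ[ S ∈ 𝔓 p ] S ξ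

  e₁ : ∀ {p} → E p → Sig
  e₁ (ξ , _ , _) = ξ

  e₂ : ∀ {p} → E p → 𝔓 p
  e₂ (_ , S , _) = S

  imageFibre : ∀ {a b} {X : Set a} {Y : Set b} →
               (X → Sig) → (X → Y) → Y → 𝔓 (a ⊔ b ⊔ s)
  imageFibre σ f y ξ = ∃ λ x → f x ≡ y × σ x ≡ ξ

module Submission where

open import Level using (Level; _⊔_)
open import Data.Product using (_×_; _,_; proj₁; Σ-syntax)
open import Function using (_∘_)
open import Relation.Binary.PropositionalEquality using (_≡_; refl)
open import Relation.Binary.Lattice.Bundles using (HeytingAlgebra)
import Relation.Binary.Reasoning.Setoid as SetoidReasoning
open import Defs

-- The square with sides f : X → Y, y ↦ {σ x | f x = y} : Y → 𝔓(Σ), and the membership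
-- projection e₂ : E → 𝔓(Σ) is a pullback, with X → E given by x ↦ (σ x , {σ x′ | f x′ = f x}).
-- That map composed with e₁ is σ, so pulling ∃ e₂ ⟦ e₁ ⟧ (resp. ∀ e₂ ⟦ e₁ ⟧) back along the
-- fibre map is, by Beck–Chevalley, ∃ f ⟦ σ ⟧ (resp. ∀ f ⟦ σ ⟧).

module _ {c ℓ s} (T : Tripos c ℓ s) where
  open Tripos T

  private
    module Fibre {x} (X : Set x) = HeytingAlgebra (P X)

  P₁-cong : ∀ {x y} {X : Set x} {Y : Set y} (f : X → Y) {φ ψ : ∣ P Y ∣} →
            Y ⊢ φ ≈ ψ → X ⊢ P₁ f φ ≈ P₁ f ψ
  P₁-cong {X = X} {Y} f φ≈ψ =
    Fibre.antisym X (P₁-mono f (Fibre.reflexive Y φ≈ψ))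
                    (P₁-mono f (Fibre.reflexive Y (Fibre.Eq.sym Y φ≈ψ)))

  ∃₁-cong : ∀ {x y} {X : Set x} {Y : Set y} (f : X → Y) {φ ψ : ∣ P X ∣} →
            X ⊢ φ ≈ ψ → Y ⊢ ∃₁ f φ ≈ ∃₁ f ψ
  ∃₁-cong {X = X} {Y} f φ≈ψ =
    Fibre.antisym Y (∃₁-mono f (Fibre.reflexive X φ≈ψ))
                    (∃₁-mono f (Fibre.reflexive X (Fibre.Eq.sym X φ≈ψ)))

  ∀₁-cong : ∀ {x y} {X : Set x} {Y : Set y} (f : X → Y) {φ ψ : ∣ P X ∣} →
            X ⊢ φ ≈ ψ → Y ⊢ ∀₁ f φ ≈ ∀₁ f ψ
  ∀₁-cong {X = X} {Y} f φ≈ψ =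
    Fibre.antisym Y (∀₁-mono f (Fibre.reflexive X φ≈ψ))
                    (∀₁-mono f (Fibre.reflexive X (Fibre.Eq.sym X φ≈ψ)))

  ⟦∘⟧ : ∀ {x y} {X : Set x} {Y : Set y} (f : X → Y) (σ : Y → Sig) →
        X ⊢ ⟦ σ ∘ f ⟧ ≈ P₁ f ⟦ σ ⟧
  ⟦∘⟧ f σ = P₁-∘ f σ trΣ

  module _ {a b} {X : Set a} {Y : Set b} (σ : X → Sig) (f : X → Y) where

    fibreGraph : X → E (a ⊔ b ⊔ s)
    fibreGraph x = σ x , imageFibre σ f (f x) , x , refl , refl

    private
      fibreGraph-gap : ∀ y e → imageFibre σ f y ≡ e₂ e →
                       Σ[ x ∈ X ] (f x ≡ y × fibreGraph x ≡ e)
      fibreGraph-gap y (_ , _ , x , refl , refl) refl = x , refl , refl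

      member-injective : ∀ {y y′} → y ≡ y′ → ∀ {ξ ξ′}
                         (w : imageFibre σ f y ξ) (w′ : imageFibre σ f y′ ξ′) →
                         _≡_ {A = E (a ⊔ b ⊔ s)} (ξ , imageFibre σ f y , w)
                                                  (ξ′ , imageFibre σ f y′ , w′) →
                         proj₁ w ≡ proj₁ w′
      member-injective refl w .w refl = refl

    imageFibre-isPullback : IsPullback f fibreGraph (imageFibre σ f) e₂
    imageFibre-isPullback = record
      { commutes = λ _ → refl
      ; gap      = fibreGraph-gap
      ; unique   = λ x x′ fx≡fx′ → member-injective fx≡fx′ (x , refl , refl) (x′ , refl , refl)
      }

    module _ (χ : 𝔓 (a ⊔ b ⊔ s) → Sig) where
      open SetoidReasoning (Fibre.setoid Y)

      ⟦∘imageFibre⟧-∃₁ : 𝔓 (a ⊔ b ⊔ s) ⊢ ⟦ χ ⟧ ≈ ∃₁ e₂ ⟦ e₁ ⟧ →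
                         Y ⊢ ⟦ χ ∘ imageFibre σ f ⟧ ≈ ∃₁ f ⟦ σ ⟧
      ⟦∘imageFibre⟧-∃₁ χ≈∃ = begin
        ⟦ χ ∘ imageFibre σ f ⟧                   ≈⟨ ⟦∘⟧ (imageFibre σ f) χ ⟩
        P₁ (imageFibre σ f) ⟦ χ ⟧                ≈⟨ P₁-cong (imageFibre σ f) χ≈∃ ⟩
        P₁ (imageFibre σ f) (∃₁ e₂ ⟦ e₁ ⟧)       ≈⟨ BC-∃ f fibreGraph (imageFibre σ f) e₂ imageFibre-isPullback ⟦ e₁ ⟧ ⟨
        ∃₁ f (P₁ fibreGraph ⟦ e₁ ⟧)              ≈⟨ ∃₁-cong f (⟦∘⟧ fibreGraph e₁) ⟨
        ∃₁ f ⟦ σ ⟧                               ∎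

      ⟦∘imageFibre⟧-∀₁ : 𝔓 (a ⊔ b ⊔ s) ⊢ ⟦ χ ⟧ ≈ ∀₁ e₂ ⟦ e₁ ⟧ →
                         Y ⊢ ⟦ χ ∘ imageFibre σ f ⟧ ≈ ∀₁ f ⟦ σ ⟧
      ⟦∘imageFibre⟧-∀₁ χ≈∀ = begin
        ⟦ χ ∘ imageFibre σ f ⟧                   ≈⟨ ⟦∘⟧ (imageFibre σ f) χ ⟩
        P₁ (imageFibre σ f) ⟦ χ ⟧                ≈⟨ P₁-cong (imageFibre σ f) χ≈∀ ⟩
        P₁ (imageFibre σ f) (∀₁ e₂ ⟦ e₁ ⟧)       ≈⟨ BC-∀ f fibreGraph (imageFibre σ f) e₂ imageFibre-isPullback ⟦ e₁ ⟧ ⟨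
        ∀₁ f (P₁ fibreGraph ⟦ e₁ ⟧)              ≈⟨ ∀₁-cong f (⟦∘⟧ fibreGraph e₁) ⟨
        ∀₁ f ⟦ σ ⟧                               ∎

  proposition2p6 : {a b : Level} →
    (⋁̇ ⋀̇ : 𝔓 (a ⊔ b ⊔ s) → Sig) →
    𝔓 (a ⊔ b ⊔ s) ⊢ ⟦ ⋁̇ ⟧ ≈ ∃₁ e₂ ⟦ e₁ ⟧ →
    𝔓 (a ⊔ b ⊔ s) ⊢ ⟦ ⋀̇ ⟧ ≈ ∀₁ e₂ ⟦ e₁ ⟧ →
    (X : Set a) (Y : Set b) (σ : X → Sig) (f : X → Y) →
    (Y ⊢ ⟦ (λ y → ⋁̇ (imageFibre σ f y)) ⟧ ≈ ∃₁ f ⟦ σ ⟧)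
      × (Y ⊢ ⟦ (λ y → ⋀̇ (imageFibre σ f y)) ⟧ ≈ ∀₁ f ⟦ σ ⟧)
  proposition2p6 ⋁̇ ⋀̇ ⋁̇≈∃ ⋀̇≈∀ X Y σ f =
    ⟦∘imageFibre⟧-∃₁ σ f ⋁̇ ⋁̇≈∃ , ⟦∘imageFibre⟧-∀₁ σ f ⋀̇ ⋀̇≈∀
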